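{- Let $a,b\ge1$ and $\pi=21[\iota_a,\iota_b]=(1+b)(2+b)\cdots(a+b)\,1\,2\cdots b$. Then $\operatorname{diam}(G_\pi)=\binom{a}{2}\binom{b}{2}$.
   Context: $\iota_k=12\cdots k$. $R(\pi)$ is the set of reduced words of $\pi\in\mathfrak S_n$ (minimal-length words $r_1\cdots r_\ell$ in $[n-1]$ with $\pi=s_{r_1}\cdots s_{r_\ell}$, $s_i=(i,i+1)$); $G_\pi$ is the graph on $R(\pi)$ whose edges join words related by one commutation move (exchange adjacent $jk$, $|j-k|>1$) or one long braid move (consecutive $j(j+1)j\leftrightarrow(j+1)j(j+1)$). Diameter = maximum distance between two vertices (one-vertex graph: $0$). -}

module Defs where

open import Data.Nat using (ℕ; zero; suc; _+_; _≤_; _<_)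
open import Data.List using (List; []; _∷_; _++_; map; upTo; foldl; length)
open import Data.List.Relation.Unary.All using (All)
open import Data.Product using (_×_; Σ; ∃; ∃-syntax)
open import Data.Sum using (_⊎_)
open import Relation.Binary.PropositionalEquality using (_≡_)

-- Permutations of [n] are represented in one-line notation as lists
-- π(1) π(2) ... π(n) of natural numbers.

ι : ℕ → List ℕ
ι k = map suc (upTo k)

-- swapAt i xs swaps the entries in positions i and i+1 (1-indexed).
-- In one-line notation this is right multiplication by s_i: (π s_i)(x) = π(s_i x).
swapAt : ℕ → List ℕ → List ℕ
swapAt (suc zero) (x ∷ y ∷ xs) = y ∷ x ∷ xs
swapAt (suc (suc i)) (x ∷ xs) = x ∷ swapAt (suc i) xs
swapAt _ xs = xs

-- the permutation s_{r1} s_{r2} ... s_{rℓ} of [n], in one-line notation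
prod : ℕ → List ℕ → List ℕ
prod n w = foldl (λ p r → swapAt r p) (ι n) w

Letter : ℕ → ℕ → Set
Letter n r = 1 ≤ r × suc r ≤ n

IsWord : ℕ → List ℕ → List ℕ → Set
IsWord n π w = All (Letter n) w × prod n w ≡ π

Reduced : ℕ → List ℕ → List ℕ → Set
Reduced n π w = IsWord n π w × (∀ w′ → IsWord n π w′ → length w ≤ length w′)

data Move : List ℕ → List ℕ → Set where
  comm   : ∀ xs ys j k → (suc k < j ⊎ suc j < k) →
           Move (xs ++ j ∷ k ∷ ys) (xs ++ k ∷ j ∷ ys)
  braid₁ : ∀ xs ys j →
           Move (xs ++ j ∷ suc j ∷ j ∷ ys) (xs ++ suc j ∷ j ∷ suc j ∷ ys)
  braid₂ : ∀ xs ys j →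
           Move (xs ++ suc j ∷ j ∷ suc j ∷ ys) (xs ++ j ∷ suc j ∷ j ∷ ys)

data Walk (n : ℕ) (π : List ℕ) : List ℕ → List ℕ → ℕ → Set where
  here : ∀ {u} → Reduced n π u → Walk n π u u 0
  step : ∀ {u v w k} → Reduced n π u → Move u v → Walk n π v w k →
         Walk n π u w (suc k)

Dist : ℕ → List ℕ → List ℕ → List ℕ → ℕ → Set
Dist n π u v d = Walk n π u v d × (∀ k → Walk n π u v k → d ≤ k)

IsDiameter : ℕ → List ℕ → ℕ → Set
IsDiameter n π D =
  (∀ u v → Reduced n π u → Reduced n π v → ∃[ d ] (Dist n π u v d × d ≤ D)) ×
  (∃[ u ] ∃[ v ] (Reduced n π u × Reduced n π v × Dist n π u v D))

π21 : ℕ → ℕ → List ℕ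
π21 a b = map (b +_) (ι a) ++ ι b

-- Replacing every entry of a permutation of [a+b] by whether it exceeds b turns a word for
-- π into a sequence of adjacent swaps taking 0ᵇ1ᵃ to 1ᵃ0ᵇ. A swap raises the number of
-- inversions (patterns 10) by at most one, so reduced words have length ab and each of their
-- letters turns a 01 into a 10; in particular no braid move applies, and G_π is a
-- commutation class.
--
-- Let the first letter x of a reduced word v swap the 01 in L01R. In another
-- reduced word u, x occurs after letters acting inside L or inside R only, at most
-- #01 L + #01 R of them, so x can be commuted to the front of u. The number Ψ of patterns
-- 0011 and 0101 drops by exactly #01 L + #01 R under that swap, so by induction u and v
-- are at distance at most Ψ(0ᵇ1ᵃ) = C(a,2)C(b,2).
--
-- Record for every letter the pair of entries (x, y) it exchanges. A
-- commutation transposes two adjacent records, so it changes the number of records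
-- (x, y) preceding some (x′, y′) with x < x′ and y < y′ by at most one. That number is
-- C(a,2)C(b,2) for the word moving b+1, …, b+a in turn leftwards past the small entries,
-- and 0 for the word moving b, …, 1 in turn rightwards past the large ones.

module Submission where

open import Defs
open import Data.Nat using (ℕ; _+_; _*_; _≤_)
open import Data.Nat.Combinatorics using (_C_; nCk+nC[k+1]≡[n+1]C[k+1]; nC1≡n)

open import Data.Bool using (Bool; true; false; _∧_)
open import Data.Bool.Properties using (∧-identityʳ; ∧-zeroʳ)
open import Data.Empty using (⊥-elim)
open import Data.List using (List; []; _∷_; _++_; map; length; replicate; foldl; applyUpTo)
open import Data.List.Properties using (length-++; ++-assoc; map-++; ++-identityʳ; ≡-dec)
open import Data.List.Relation.Binary.Permutation.Propositional as ↭ using (_↭_)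
import Data.List.Relation.Binary.Permutation.Propositional.Properties as ↭
open import Data.List.Relation.Unary.All as All using (All; []; _∷_)
import Data.List.Relation.Unary.All.Properties as All
open import Data.List.Relation.Unary.Any as Any using (Any)
import Data.List.Relation.Unary.Any.Properties as Any
open import Data.Nat using (zero; suc; _<_; _<ᵇ_; z≤n; s≤s; _≟_; _<?_)
open import Data.Nat.Properties
open import Data.Nat.Tactic.RingSolver using (solve-∀)
open import Data.Product as Product using (_×_; ∃; ∃-syntax; _,_; proj₁; proj₂)
open import Data.Sum as Sum using (_⊎_; inj₁; inj₂)
open import Data.Unit using (⊤; tt)
open import Relation.Binary.PropositionalEquality
open import Relation.Nullary using (¬_; Dec; yes; no)
open import Relation.Nullary.Decidable using (_⊎-dec_)

-- Adjacent transpositions acting on positions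

swap : {A : Set} → ℕ → List A → List A
swap (suc zero)    (x ∷ y ∷ xs) = y ∷ x ∷ xs
swap (suc (suc i)) (x ∷ xs)     = x ∷ swap (suc i) xs
swap _             xs           = xs

act : {A : Set} → List A → List ℕ → List A
act s []      = s
act s (r ∷ w) = act (swap r s) w

swapAt≡swap : ∀ r l → swapAt r l ≡ swap r l
swapAt≡swap zero          l           = refl
swapAt≡swap (suc zero)    []          = refl
swapAt≡swap (suc zero)    (x ∷ [])    = refl
swapAt≡swap (suc zero)    (x ∷ y ∷ l) = refl
swapAt≡swap (suc (suc r)) []          = refl
swapAt≡swap (suc (suc r)) (x ∷ l)     = cong (x ∷_) (swapAt≡swap (suc r) l)

prod≡act : ∀ n w → prod n w ≡ act (ι n) w
prod≡act n w = go (ι n) w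
  where
  go : ∀ s w → foldl (λ p r → swapAt r p) s w ≡ act s w
  go s []      = refl
  go s (r ∷ w) rewrite swapAt≡swap r s = go (swap r s) w

length-swap : {A : Set} → ∀ r (l : List A) → length (swap r l) ≡ length l
length-swap zero          l           = refl
length-swap (suc zero)    []          = refl
length-swap (suc zero)    (x ∷ [])    = refl
length-swap (suc zero)    (x ∷ y ∷ l) = refl
length-swap (suc (suc r)) []          = refl
length-swap (suc (suc r)) (x ∷ l)     = cong suc (length-swap (suc r) l)

map-swap : {A B : Set} (f : A → B) → ∀ r l → map f (swap r l) ≡ swap r (map f l)
map-swap f zero          l           = refl
map-swap f (suc zero)    []          = refl
map-swap f (suc zero)    (x ∷ [])    = refl
map-swap f (suc zero)    (x ∷ y ∷ l) = refl
map-swap f (suc (suc r)) []          = refl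
map-swap f (suc (suc r)) (x ∷ l)     = cong (f x ∷_) (map-swap f (suc r) l)

map-act : {A B : Set} (f : A → B) → ∀ s w → map f (act s w) ≡ act (map f s) w
map-act f s []      = refl
map-act f s (r ∷ w) = trans (map-act f (swap r s) w) (cong (λ t → act t w) (map-swap f r s))

act-++ : {A : Set} → ∀ (s : List A) w w′ → act s (w ++ w′) ≡ act (act s w) w′
act-++ s []      w′ = refl
act-++ s (r ∷ w) w′ = act-++ (swap r s) w w′

swap-middle : {A : Set} → ∀ (P : List A) x y M →
              swap (suc (length P)) (P ++ x ∷ y ∷ M) ≡ P ++ y ∷ x ∷ M
swap-middle []      x y M = refl
swap-middle (p ∷ P) x y M = cong (p ∷_) (swap-middle P x y M)

swap-++ʳ : {A : Set} → ∀ (P : List A) r M →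
           swap (suc (length P + r)) (P ++ M) ≡ P ++ swap (suc r) M
swap-++ʳ []      r M = refl
swap-++ʳ (p ∷ P) r M = cong (p ∷_) (swap-++ʳ P r M)

Far : ℕ → ℕ → Set
Far j k = suc k < j ⊎ suc j < k

Far-sym : ∀ {j k} → Far j k → Far k j
Far-sym (inj₁ h) = inj₂ h
Far-sym (inj₂ h) = inj₁ h

far? : ∀ j k → Dec (Far j k)
far? j k = (suc k <? j) ⊎-dec (suc j <? k)

swap-comm : {A : Set} → ∀ j k (l : List A) → suc k < j → swap j (swap k l) ≡ swap k (swap j l)
swap-comm j             zero          l           _ = refl
swap-comm .(3 + _)     (suc zero)    []          (s≤s (s≤s (s≤s _))) = refl
swap-comm .(3 + _)     (suc zero)    (x ∷ [])    (s≤s (s≤s (s≤s _))) = refl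
swap-comm .(3 + _)     (suc zero)    (x ∷ y ∷ l) (s≤s (s≤s (s≤s _))) = refl
swap-comm (suc zero)    (suc (suc k)) l           (s≤s ())
swap-comm (suc (suc j)) (suc (suc k)) []          _ = refl
swap-comm (suc (suc j)) (suc (suc k)) (x ∷ l)     (s≤s k<j) = cong (x ∷_) (swap-comm (suc j) (suc k) l k<j)

swap-comm-far : {A : Set} → ∀ j k (l : List A) → Far j k → swap j (swap k l) ≡ swap k (swap j l)
swap-comm-far j k l (inj₁ k<j) = swap-comm j k l k<j
swap-comm-far j k l (inj₂ j<k) = sym (swap-comm k j l j<k)

act-commute : {A : Set} → ∀ (s : List A) xs ys j k → Far j k →
              act s (xs ++ j ∷ k ∷ ys) ≡ act s (xs ++ k ∷ j ∷ ys)
act-commute s xs ys j k far = begin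
  act s (xs ++ j ∷ k ∷ ys)              ≡⟨ act-++ s xs _ ⟩
  act (swap k (swap j (act s xs))) ys   ≡⟨ cong (λ t → act t ys) (swap-comm-far k j _ (Far-sym far)) ⟩
  act (swap j (swap k (act s xs))) ys   ≡⟨ sym (act-++ s xs _) ⟩
  act s (xs ++ k ∷ j ∷ ys)              ∎
  where open ≡-Reasoning

-- Bit strings

data Ascent : ℕ → List Bool → Set where
  head-ascent : ∀ R → Ascent 1 (false ∷ true ∷ R)
  tail-ascent : ∀ {r x S} → Ascent (suc r) S → Ascent (suc (suc r)) (x ∷ S)

AscentWord : List Bool → List ℕ → Set
AscentWord S []      = ⊤
AscentWord S (r ∷ w) = Ascent r S × AscentWord (swap r S) w

NoAscent : List Bool → Set
NoAscent S = ∀ r → ¬ Ascent r S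

-- #p S is the number of occurrences of the pattern p (0 = false, 1 = true)
-- as a subsequence of S; Ψ S counts the occurrences of 0011 and of 0101.

#0 #1 #01 #10 #11 #011 #101 Ψ : List Bool → ℕ
#0 []          = 0
#0 (false ∷ s) = suc (#0 s)
#0 (true ∷ s)  = #0 s

#1 []          = 0
#1 (false ∷ s) = #1 s
#1 (true ∷ s)  = suc (#1 s)

#01 []          = 0
#01 (false ∷ s) = #1 s + #01 s
#01 (true ∷ s)  = #01 s

#10 []          = 0
#10 (false ∷ s) = #10 s
#10 (true ∷ s)  = #0 s + #10 s

#11 []          = 0
#11 (false ∷ s) = #11 s
#11 (true ∷ s)  = #1 s + #11 s

#011 []          = 0
#011 (false ∷ s) = #11 s + #011 s
#011 (true ∷ s)  = #011 s

#101 []          = 0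
#101 (false ∷ s) = #101 s
#101 (true ∷ s)  = #01 s + #101 s

Ψ []          = 0
Ψ (false ∷ s) = #011 s + #101 s + Ψ s
Ψ (true ∷ s)  = Ψ s

#0-swap : ∀ r S → #0 (swap r S) ≡ #0 S
#0-swap zero          S                   = refl
#0-swap (suc zero)    []                  = refl
#0-swap (suc zero)    (x ∷ [])            = refl
#0-swap (suc zero)    (false ∷ false ∷ S) = refl
#0-swap (suc zero)    (false ∷ true ∷ S)  = refl
#0-swap (suc zero)    (true ∷ false ∷ S)  = refl
#0-swap (suc zero)    (true ∷ true ∷ S)   = refl
#0-swap (suc (suc r)) []                  = refl
#0-swap (suc (suc r)) (false ∷ S)         = cong suc (#0-swap (suc r) S)
#0-swap (suc (suc r)) (true ∷ S)          = #0-swap (suc r) S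

#1-swap : ∀ r S → #1 (swap r S) ≡ #1 S
#1-swap zero          S                   = refl
#1-swap (suc zero)    []                  = refl
#1-swap (suc zero)    (x ∷ [])            = refl
#1-swap (suc zero)    (false ∷ false ∷ S) = refl
#1-swap (suc zero)    (false ∷ true ∷ S)  = refl
#1-swap (suc zero)    (true ∷ false ∷ S)  = refl
#1-swap (suc zero)    (true ∷ true ∷ S)   = refl
#1-swap (suc (suc r)) []                  = refl
#1-swap (suc (suc r)) (false ∷ S)         = #1-swap (suc r) S
#1-swap (suc (suc r)) (true ∷ S)          = cong suc (#1-swap (suc r) S)

#10-swap : ∀ r S → Ascent r S ⊎ #10 (swap r S) ≤ #10 S
#10-swap zero          S                   = inj₂ ≤-refl
#10-swap (suc zero)    []                  = inj₂ ≤-refl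
#10-swap (suc zero)    (x ∷ [])            = inj₂ ≤-refl
#10-swap (suc zero)    (false ∷ false ∷ S) = inj₂ ≤-refl
#10-swap (suc zero)    (false ∷ true ∷ S)  = inj₁ (head-ascent S)
#10-swap (suc zero)    (true ∷ false ∷ S)  = inj₂ (n≤1+n _)
#10-swap (suc zero)    (true ∷ true ∷ S)   = inj₂ ≤-refl
#10-swap (suc (suc r)) []                  = inj₂ ≤-refl
#10-swap (suc (suc r)) (false ∷ S)         = Sum.map₁ tail-ascent (#10-swap (suc r) S)
#10-swap (suc (suc r)) (true ∷ S)          =
  Sum.map tail-ascent (+-mono-≤ (≤-reflexive (#0-swap (suc r) S))) (#10-swap (suc r) S)

#10-swap-ascent : ∀ {r S} → Ascent r S → #10 (swap r S) ≡ suc (#10 S)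
#10-swap-ascent (head-ascent R)                  = refl
#10-swap-ascent (tail-ascent {x = false} a)      = #10-swap-ascent a
#10-swap-ascent (tail-ascent {r} {true} {S} a) =
  trans (cong₂ _+_ (#0-swap (suc r) S) (#10-swap-ascent a)) (+-suc (#0 S) (#10 S))

#01-swap-ascent : ∀ {r S} → Ascent r S → suc (#01 (swap r S)) ≡ #01 S
#01-swap-ascent (head-ascent R)                   = refl
#01-swap-ascent (tail-ascent {r} {false} {S} a) rewrite #1-swap (suc r) S =
  trans (sym (+-suc (#1 S) _)) (cong (#1 S +_) (#01-swap-ascent a))
#01-swap-ascent (tail-ascent {x = true} a)        = #01-swap-ascent a

#10-swap-≤ : ∀ r S → #10 (swap r S) ≤ suc (#10 S)
#10-swap-≤ r S with #10-swap r S
... | inj₁ a  = ≤-reflexive (#10-swap-ascent a)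
... | inj₂ le = m≤n⇒m≤1+n le

#10-act-≤ : ∀ S w → #10 (act S w) ≤ length w + #10 S
#10-act-≤ S []      = ≤-refl
#10-act-≤ S (r ∷ w) = begin
  #10 (act (swap r S) w)       ≤⟨ #10-act-≤ (swap r S) w ⟩
  length w + #10 (swap r S)    ≤⟨ +-monoʳ-≤ (length w) (#10-swap-≤ r S) ⟩
  length w + suc (#10 S)       ≡⟨ +-suc (length w) (#10 S) ⟩
  suc (length w + #10 S)       ∎
  where open ≤-Reasoning

AscentWord⇒#10-act : ∀ S w → AscentWord S w → #10 (act S w) ≡ length w + #10 S
AscentWord⇒#10-act S []      _        = refl
AscentWord⇒#10-act S (r ∷ w) (a , aw) = begin
  #10 (act (swap r S) w)       ≡⟨ AscentWord⇒#10-act (swap r S) w aw ⟩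
  length w + #10 (swap r S)    ≡⟨ cong (length w +_) (#10-swap-ascent a) ⟩
  length w + suc (#10 S)       ≡⟨ +-suc (length w) (#10 S) ⟩
  suc (length w + #10 S)       ∎
  where open ≡-Reasoning

#10-act⇒AscentWord : ∀ S w → #10 (act S w) ≡ length w + #10 S → AscentWord S w
#10-act⇒AscentWord S []      _ = tt
#10-act⇒AscentWord S (r ∷ w) e with #10-swap r S
... | inj₁ a  = a , #10-act⇒AscentWord (swap r S) w (begin
  #10 (act (swap r S) w)       ≡⟨ e ⟩
  suc (length w + #10 S)       ≡⟨ sym (+-suc (length w) (#10 S)) ⟩
  length w + suc (#10 S)       ≡⟨ cong (length w +_) (sym (#10-swap-ascent a)) ⟩
  length w + #10 (swap r S)    ∎)
  where open ≡-Reasoning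
... | inj₂ le = ⊥-elim (<-irrefl refl (begin-strict
  length w + #10 S             <⟨ ≤-reflexive (sym e) ⟩
  #10 (act (swap r S) w)       ≤⟨ #10-act-≤ (swap r S) w ⟩
  length w + #10 (swap r S)    ≤⟨ +-monoʳ-≤ (length w) le ⟩
  length w + #10 S             ∎))
  where open ≤-Reasoning

infixr 5 _⟨01⟩_ _⟨10⟩_
_⟨01⟩_ _⟨10⟩_ : List Bool → List Bool → List Bool
L ⟨01⟩ R = L ++ false ∷ true ∷ R
L ⟨10⟩ R = L ++ true ∷ false ∷ R

ascent-middle : ∀ L R → Ascent (suc (length L)) (L ⟨01⟩ R)
ascent-middle []      R = head-ascent R
ascent-middle (x ∷ L) R = tail-ascent (ascent-middle L R)

ascent-bound : ∀ {r S} → Ascent r S → suc r ≤ length S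
ascent-bound (head-ascent R) = s≤s (s≤s z≤n)
ascent-bound (tail-ascent a) = s≤s (ascent-bound a)

ascent-decompose : ∀ {r S} → Ascent r S → ∃[ L ] ∃[ R ] (S ≡ L ⟨01⟩ R × r ≡ suc (length L))
ascent-decompose (head-ascent R) = [] , R , refl , refl
ascent-decompose (tail-ascent {x = x} a) with ascent-decompose a
... | L , R , refl , refl = x ∷ L , R , refl , refl

swap-ascent-++ : ∀ {r L} → Ascent r L → ∀ M → swap r (L ++ M) ≡ swap r L ++ M
swap-ascent-++ (head-ascent R)         M = refl
swap-ascent-++ (tail-ascent {x = x} a) M = cong (x ∷_) (swap-ascent-++ a M)

ascent-around : ∀ L {R r} → Ascent r (L ⟨01⟩ R) →
  Ascent r L ⊎ r ≡ suc (length L) ⊎ ∃[ r′ ] (Ascent r′ R × r ≡ suc (length L + suc r′))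
ascent-around []                 (head-ascent _)               = inj₂ (inj₁ refl)
ascent-around []                 (tail-ascent (tail-ascent a)) = inj₂ (inj₂ (_ , a , refl))
ascent-around (false ∷ true ∷ L) (head-ascent _)               = inj₁ (head-ascent L)
ascent-around (y ∷ L)            (tail-ascent a)               =
  Sum.map tail-ascent (Sum.map (cong suc) (Product.map₂ (Product.map₂ (cong suc))))
    (ascent-around L a)

no-braid₁ : ∀ {j S} → Ascent j S → Ascent (suc j) (swap j S) →
            ¬ Ascent j (swap (suc j) (swap j S))
no-braid₁ (head-ascent _) (tail-ascent (head-ascent _)) ()
no-braid₁ (tail-ascent a) (tail-ascent b) (tail-ascent c) = no-braid₁ a b c

no-braid₂ : ∀ {j S} → Ascent (suc j) S → Ascent j (swap (suc j) S) →
            ¬ Ascent (suc j) (swap j (swap (suc j) S))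
no-braid₂ (tail-ascent (head-ascent _)) (head-ascent _) (tail-ascent ())
no-braid₂ (tail-ascent a) (tail-ascent b) (tail-ascent c) = no-braid₂ a b c

#1-flip : ∀ L R → #1 (L ⟨01⟩ R) ≡ #1 (L ⟨10⟩ R)
#1-flip []          R = refl
#1-flip (false ∷ L) R = #1-flip L R
#1-flip (true ∷ L)  R = cong suc (#1-flip L R)

#01-flip : ∀ L R → #01 (L ⟨01⟩ R) ≡ suc (#01 (L ⟨10⟩ R))
#01-flip []          R = refl
#01-flip (false ∷ L) R =
  trans (cong₂ _+_ (#1-flip L R) (#01-flip L R)) (+-suc (#1 (L ⟨10⟩ R)) _)
#01-flip (true ∷ L)  R = #01-flip L R

#11-flip : ∀ L R → #11 (L ⟨01⟩ R) ≡ #11 (L ⟨10⟩ R)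
#11-flip []          R = refl
#11-flip (false ∷ L) R = #11-flip L R
#11-flip (true ∷ L)  R = cong₂ _+_ (#1-flip L R) (#11-flip L R)

#011-flip : ∀ L R → #011 (L ⟨01⟩ R) ≡ #011 (L ⟨10⟩ R) + #1 R
#011-flip []          R = arith (#1 R) (#11 R) (#011 R)
  where arith : ∀ a b c → (a + b) + c ≡ (b + c) + a
        arith = solve-∀
#011-flip (false ∷ L) R =
  trans (cong₂ _+_ (#11-flip L R) (#011-flip L R)) (sym (+-assoc (#11 (L ⟨10⟩ R)) _ (#1 R)))
#011-flip (true ∷ L)  R = #011-flip L R

#101-flip : ∀ L R → #101 (L ⟨01⟩ R) + #1 R ≡ #101 (L ⟨10⟩ R) + #1 L
#101-flip []          R = arith (#1 R) (#01 R) (#101 R)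
  where arith : ∀ a b c → (b + c) + a ≡ ((a + b) + c) + 0
        arith = solve-∀
#101-flip (false ∷ L) R = #101-flip L R
#101-flip (true ∷ L)  R = begin
  #01 (L ⟨01⟩ R) + #101 (L ⟨01⟩ R) + #1 R           ≡⟨ +-assoc (#01 (L ⟨01⟩ R)) _ _ ⟩
  #01 (L ⟨01⟩ R) + (#101 (L ⟨01⟩ R) + #1 R)         ≡⟨ cong₂ _+_ (#01-flip L R) (#101-flip L R) ⟩
  suc (#01 (L ⟨10⟩ R)) + (#101 (L ⟨10⟩ R) + #1 L)   ≡⟨ arith (#01 (L ⟨10⟩ R)) _ (#1 L) ⟩
  #01 (L ⟨10⟩ R) + #101 (L ⟨10⟩ R) + suc (#1 L)     ∎
  where open ≡-Reasoning
        arith : ∀ a b c → suc a + (b + c) ≡ a + b + suc c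
        arith = solve-∀

Ψ-flip : ∀ L R → Ψ (L ⟨01⟩ R) ≡ #01 L + #01 R + Ψ (L ⟨10⟩ R)
Ψ-flip []          R = arith (#011 R) (#101 R) (#01 R) (Ψ R)
  where arith : ∀ a b c p → a + (c + b) + p ≡ c + (a + b + p)
        arith = solve-∀
Ψ-flip (false ∷ L) R = begin
  #011 (L ⟨01⟩ R) + #101 (L ⟨01⟩ R) + Ψ (L ⟨01⟩ R)
    ≡⟨ cong₂ (λ s t → s + #101 (L ⟨01⟩ R) + t) (#011-flip L R) (Ψ-flip L R) ⟩
  #011 (L ⟨10⟩ R) + #1 R + #101 (L ⟨01⟩ R) + (#01 L + #01 R + Ψ (L ⟨10⟩ R))
    ≡⟨ arith₁ (#011 (L ⟨10⟩ R)) (#1 R) (#101 (L ⟨01⟩ R)) (#01 L + #01 R + Ψ (L ⟨10⟩ R)) ⟩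
  (#101 (L ⟨01⟩ R) + #1 R) + (#011 (L ⟨10⟩ R) + (#01 L + #01 R + Ψ (L ⟨10⟩ R)))
    ≡⟨ cong (_+ (#011 (L ⟨10⟩ R) + (#01 L + #01 R + Ψ (L ⟨10⟩ R)))) (#101-flip L R) ⟩
  (#101 (L ⟨10⟩ R) + #1 L) + (#011 (L ⟨10⟩ R) + (#01 L + #01 R + Ψ (L ⟨10⟩ R)))
    ≡⟨ arith₂ (#101 (L ⟨10⟩ R)) (#1 L) (#011 (L ⟨10⟩ R)) (#01 L) (#01 R) (Ψ (L ⟨10⟩ R)) ⟩
  #1 L + #01 L + #01 R + (#011 (L ⟨10⟩ R) + #101 (L ⟨10⟩ R) + Ψ (L ⟨10⟩ R))
    ∎
  where open ≡-Reasoning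
        arith₁ : ∀ a n x q → a + n + x + q ≡ (x + n) + (a + q)
        arith₁ = solve-∀
        arith₂ : ∀ y n a cl cr p → (y + n) + (a + (cl + cr + p)) ≡ n + cl + cr + (a + y + p)
        arith₂ = solve-∀
Ψ-flip (true ∷ L)  R = Ψ-flip L R

-- Commutation classes

data Commutation : List ℕ → List ℕ → Set where
  commute : ∀ xs ys j k → Far j k → Commutation (xs ++ j ∷ k ∷ ys) (xs ++ k ∷ j ∷ ys)

infixr 5 _◅_ _◅◅_
data CommPath : List ℕ → List ℕ → ℕ → Set where
  ε   : ∀ {u} → CommPath u u 0
  _◅_ : ∀ {u v w k} → Commutation u v → CommPath v w k → CommPath u w (suc k)

_◅◅_ : ∀ {u v w k m} → CommPath u v k → CommPath v w m → CommPath u w (k + m)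
ε       ◅◅ q = q
(c ◅ p) ◅◅ q = c ◅ (p ◅◅ q)

∷-commutation : ∀ x {u v} → Commutation u v → Commutation (x ∷ u) (x ∷ v)
∷-commutation x (commute xs ys j k far) = commute (x ∷ xs) ys j k far

∷-commPath : ∀ x {u v k} → CommPath u v k → CommPath (x ∷ u) (x ∷ v) k
∷-commPath x ε       = ε
∷-commPath x (c ◅ p) = ∷-commutation x c ◅ ∷-commPath x p

commutation-act : {A : Set} (s : List A) → ∀ {u v} → Commutation u v → act s u ≡ act s v
commutation-act s (commute xs ys j k far) = act-commute s xs ys j k far

commPath-act : {A : Set} (s : List A) → ∀ {u v k} → CommPath u v k → act s u ≡ act s v
commPath-act s ε       = refl
commPath-act s (c ◅ p) = trans (commutation-act s c) (commPath-act s p)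

commutation-↭ : ∀ {u v} → Commutation u v → u ↭ v
commutation-↭ (commute xs ys j k _) = ↭.++⁺ˡ xs (↭.swap j k ↭.refl)

commPath-length : ∀ {u v k} → CommPath u v k → length u ≡ length v
commPath-length ε       = refl
commPath-length (c ◅ p) = trans (↭.↭-length (commutation-↭ c)) (commPath-length p)

commPath-AscentWord : ∀ {S u v k} → AscentWord S u → CommPath u v k → AscentWord S v
commPath-AscentWord {S} {u} {v} aw p = #10-act⇒AscentWord S v (begin
  #10 (act S v)          ≡⟨ cong #10 (commPath-act S p) ⟨
  #10 (act S u)          ≡⟨ AscentWord⇒#10-act S u aw ⟩
  length u + #10 S       ≡⟨ cong (_+ #10 S) (commPath-length p) ⟩
  length v + #10 S       ∎)
  where open ≡-Reasoning

AscentWord-drop : ∀ S xs {ys} → AscentWord S (xs ++ ys) → AscentWord (act S xs) ys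
AscentWord-drop S []       aw        = aw
AscentWord-drop S (r ∷ xs) (_ , aw) = AscentWord-drop (swap r S) xs aw

AscentWord-move⇒commutation : ∀ {S u v} → AscentWord S u → Move u v → Commutation u v
AscentWord-move⇒commutation     aw (comm xs ys j k far) = commute xs ys j k far
AscentWord-move⇒commutation {S} aw (braid₁ xs ys j) with AscentWord-drop S xs aw
... | a₁ , a₂ , a₃ , _ = ⊥-elim (no-braid₁ a₁ a₂ a₃)
AscentWord-move⇒commutation {S} aw (braid₂ xs ys j) with AscentWord-drop S xs aw
... | a₁ , a₂ , a₃ , _ = ⊥-elim (no-braid₂ a₁ a₂ a₃)

commutation-IsWord : ∀ {n π u v} → Commutation u v → IsWord n π u → IsWord n π v
commutation-IsWord {n} {u = u} {v} c (letters , u↦π) =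
  ↭.All-resp-↭ (commutation-↭ c) letters ,
  trans (prod≡act n v) (trans (sym (commutation-act (ι n) c)) (trans (sym (prod≡act n u)) u↦π))

commutation-Reduced : ∀ {n π u v} → Reduced n π u → Commutation u v → Reduced n π v
commutation-Reduced (word , minimal) c =
  commutation-IsWord c word ,
  λ w′ word′ → subst (_≤ length w′) (↭.↭-length (commutation-↭ c)) (minimal w′ word′)

commPath⇒walk : ∀ {n π u v k} → Reduced n π u → CommPath u v k → Walk n π u v k
commPath⇒walk r ε                       = here r
commPath⇒walk r (commute xs ys j k far ◅ p) =
  step r (comm xs ys j k far) (commPath⇒walk (commutation-Reduced r (commute xs ys j k far)) p)

commutationsAtHead : ∀ j rest → List (∃ (Commutation (j ∷ rest)))
commutationsAtHead j []       = []
commutationsAtHead j (k ∷ ys) with far? j k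
... | yes far = (k ∷ j ∷ ys , commute [] ys j k far) ∷ []
... | no _    = []

commutations : ∀ u → List (∃ (Commutation u))
commutations []         = []
commutations (j ∷ rest) =
  commutationsAtHead j rest ++ map (Product.map (j ∷_) (∷-commutation j)) (commutations rest)

commutations-complete : ∀ {u v} → Commutation u v → Any (λ c → proj₁ c ≡ v) (commutations u)
commutations-complete (commute [] ys j k far) = Any.++⁺ˡ head
  where
  head : Any (λ c → proj₁ c ≡ k ∷ j ∷ ys) (commutationsAtHead j (k ∷ ys))
  head with far? j k
  ... | yes _   = Any.here refl
  ... | no ¬far = ⊥-elim (¬far far)
commutations-complete (commute (x ∷ xs) ys j k far) =
  Any.++⁺ʳ (commutationsAtHead x _)
    (Any.map⁺ (Any.map (cong (x ∷_)) (commutations-complete (commute xs ys j k far))))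

commPath? : ∀ k u v → Dec (CommPath u v k)
commPath? zero    u v with ≡-dec _≟_ u v
... | yes refl = yes ε
... | no u≢v   = no λ { ε → u≢v refl }
commPath? (suc k) u v with Any.any? (λ c → commPath? k (proj₁ c) v) (commutations u)
... | yes found = let ((_ , c) , p) = Any.satisfied found in yes (c ◅ p)
... | no ¬found = no λ { (c ◅ p) → ¬found (Any.map (λ { refl → p }) (commutations-complete c)) }

least : {P : ℕ → Set} → (∀ k → Dec (P k)) → ∀ {n} → P n →
        ∃[ d ] (P d × ∀ k → P k → d ≤ k)
least P? {zero}  p = 0 , p , λ _ _ → z≤n
least P? {suc n} p with P? 0
... | yes p₀ = 0 , p₀ , λ _ _ → z≤n
... | no ¬p₀ with least (λ k → P? (suc k)) p
...   | d , pd , minimal =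
  suc d , pd , λ { zero p₀ → ⊥-elim (¬p₀ p₀) ; (suc k) pk → s≤s (minimal k pk) }

-- Upper bound

PathToFront : List ℕ → ℕ → ℕ → Set
PathToFront w x n = ∃[ post ] ∃[ k ] (CommPath w (x ∷ post) k × k ≤ n)

pull-past : ∀ {r x w n} → Far r x → PathToFront w x n → PathToFront (r ∷ w) x (suc n)
pull-past {r} {x} far (post , k , p , k≤n) =
  r ∷ post , suc k ,
  subst (CommPath _ _) (+-comm k 1) (∷-commPath r p ◅◅ commute [] post r x far ◅ ε) , s≤s k≤n

bring-to-front : ∀ L R {S} w → S ≡ L ⟨01⟩ R → AscentWord S w → NoAscent (act S w) →
                 PathToFront w (suc (length L)) (#01 L + #01 R)
bring-to-front L R []      refl _        stuck = ⊥-elim (stuck _ (ascent-middle L R))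
bring-to-front L R (r ∷ w) refl (a , aw) stuck with r ≟ suc (length L) | ascent-around L a
... | yes refl | _               = w , 0 , ε , z≤n
... | no r≢x   | inj₂ (inj₁ r≡x) = ⊥-elim (r≢x r≡x)
... | no _     | inj₁ aL         =
  subst₂ (PathToFront (r ∷ w)) (cong suc (length-swap r L)) (cong (_+ #01 R) (#01-swap-ascent aL))
    (pull-past (inj₂ (s≤s (subst (suc r ≤_) (sym (length-swap r L)) (ascent-bound aL))))
      (bring-to-front (swap r L) R w (swap-ascent-++ aL (false ∷ true ∷ R)) aw stuck))
... | no _     | inj₂ (inj₂ (suc r′ , aR , refl)) =
  subst (PathToFront (r ∷ w) (suc (length L)))
        (trans (sym (+-suc (#01 L) _)) (cong (#01 L +_) (#01-swap-ascent aR)))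
    (pull-past (inj₁ (far (length L) r′))
      (bring-to-front L (swap (suc r′) R) w (swap-++ʳ L (suc (suc r′)) (false ∷ true ∷ R)) aw stuck))
  where
  far : ∀ l r′ → suc (suc l) < suc (l + suc (suc r′))
  far l r′ = s≤s (subst (_≤ l + suc (suc r′)) (+-comm l 2) (+-monoʳ-≤ l (s≤s (s≤s z≤n))))

connect : ∀ S w w′ → AscentWord S w → AscentWord S w′ → act S w ≡ act S w′ → NoAscent (act S w) →
          ∃[ k ] (CommPath w w′ k × k ≤ Ψ S)
connect S []      []       _       _         _ _     = 0 , ε , z≤n
connect S (r ∷ w) []       (a , _) _         e stuck = ⊥-elim (stuck r (subst (Ascent r) (sym e) a))
connect S w       (x ∷ w′) aw      (a , aw′) e stuck with ascent-decompose a
... | L , R , refl , refl with bring-to-front L R w refl aw stuck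
...   | post , k , p , k≤ with connect (swap x S) post w′ (proj₂ (commPath-AscentWord aw p)) aw′
                                 (trans (sym (commPath-act S p)) e) (subst NoAscent (commPath-act S p) stuck)
...     | k′ , p′ , k′≤ = k + k′ , p ◅◅ ∷-commPath x p′ , (begin
  k + k′                                 ≤⟨ +-mono-≤ k≤ k′≤ ⟩
  #01 L + #01 R + Ψ (swap x S)           ≡⟨ cong (λ T → #01 L + #01 R + Ψ T) (swap-middle L false true R) ⟩
  #01 L + #01 R + Ψ (L ⟨10⟩ R)           ≡⟨ Ψ-flip L R ⟨
  Ψ S                                    ∎)
  where open ≤-Reasoning

-- Lower bound

swappedPair : ℕ → List ℕ → ℕ × ℕ
swappedPair (suc zero)    (x ∷ y ∷ _) = x , y
swappedPair (suc (suc i)) (_ ∷ xs)    = swappedPair (suc i) xs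
swappedPair _             _           = 0 , 0

swappedPairs : List ℕ → List ℕ → List (ℕ × ℕ)
swappedPairs l []      = []
swappedPairs l (r ∷ w) = swappedPair r l ∷ swappedPairs (swap r l) w

swappedPairs-++ : ∀ l w w′ → swappedPairs l (w ++ w′) ≡ swappedPairs l w ++ swappedPairs (act l w) w′
swappedPairs-++ l []      w′ = refl
swappedPairs-++ l (r ∷ w) w′ = cong (swappedPair r l ∷_) (swappedPairs-++ (swap r l) w w′)

swappedPair-middle : ∀ P x y M → swappedPair (suc (length P)) (P ++ x ∷ y ∷ M) ≡ (x , y)
swappedPair-middle []      x y M = refl
swappedPair-middle (p ∷ P) x y M = swappedPair-middle P x y M

swappedPair-swap : ∀ j k l → suc k < j → swappedPair k (swap j l) ≡ swappedPair k l
swappedPair-swap j             zero          l           _ = refl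
swappedPair-swap .(3 + _)      (suc zero)    []          (s≤s (s≤s (s≤s _))) = refl
swappedPair-swap .(3 + _)      (suc zero)    (x ∷ [])    (s≤s (s≤s (s≤s _))) = refl
swappedPair-swap .(3 + _)      (suc zero)    (x ∷ y ∷ l) (s≤s (s≤s (s≤s _))) = refl
swappedPair-swap (suc zero)    (suc (suc k)) l           (s≤s ())
swappedPair-swap (suc (suc j)) (suc (suc k)) []          _ = refl
swappedPair-swap (suc (suc j)) (suc (suc k)) (x ∷ l)     (s≤s k<j) = swappedPair-swap (suc j) (suc k) l k<j

swappedPair-swap′ : ∀ j k l → suc j < k → swappedPair k (swap j l) ≡ swappedPair k l
swappedPair-swap′ zero          k             l           _ = refl
swappedPair-swap′ (suc zero)    .(3 + _)      []          (s≤s (s≤s (s≤s _))) = refl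
swappedPair-swap′ (suc zero)    .(3 + _)      (x ∷ [])    (s≤s (s≤s (s≤s _))) = refl
swappedPair-swap′ (suc zero)    .(3 + _)      (x ∷ y ∷ l) (s≤s (s≤s (s≤s _))) = refl
swappedPair-swap′ (suc (suc j)) (suc zero)    l           (s≤s ())
swappedPair-swap′ (suc (suc j)) (suc (suc k)) []          _ = refl
swappedPair-swap′ (suc (suc j)) (suc (suc k)) (x ∷ l)     (s≤s j<k) = swappedPair-swap′ (suc j) (suc k) l j<k

swappedPair-swap-far : ∀ j k l → Far j k → swappedPair k (swap j l) ≡ swappedPair k l
swappedPair-swap-far j k l (inj₁ k<j) = swappedPair-swap j k l k<j
swappedPair-swap-far j k l (inj₂ j<k) = swappedPair-swap′ j k l j<k

fromBool : Bool → ℕ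
fromBool false = 0
fromBool true  = 1

fromBool≤1 : ∀ x → fromBool x ≤ 1
fromBool≤1 false = z≤n
fromBool≤1 true  = ≤-refl

infix 4 _≺ᵇ_
_≺ᵇ_ : ℕ × ℕ → ℕ × ℕ → Bool
(x , y) ≺ᵇ (x′ , y′) = (x <ᵇ x′) ∧ (y <ᵇ y′)

#above : ℕ × ℕ → List (ℕ × ℕ) → ℕ
#above e []      = 0
#above e (f ∷ E) = fromBool (e ≺ᵇ f) + #above e E

#ordered : List (ℕ × ℕ) → ℕ
#ordered []      = 0
#ordered (e ∷ E) = #above e E + #ordered E

#orderedAcross : List (ℕ × ℕ) → List (ℕ × ℕ) → ℕ
#orderedAcross []      Y = 0
#orderedAcross (e ∷ X) Y = #above e Y + #orderedAcross X Y

#above-++ : ∀ e X Y → #above e (X ++ Y) ≡ #above e X + #above e Y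
#above-++ e []      Y = refl
#above-++ e (f ∷ X) Y =
  trans (cong (fromBool (e ≺ᵇ f) +_) (#above-++ e X Y)) (sym (+-assoc (fromBool (e ≺ᵇ f)) _ _))

#ordered-++ : ∀ X Y → #ordered (X ++ Y) ≡ #orderedAcross X Y + #ordered X + #ordered Y
#ordered-++ []      Y = refl
#ordered-++ (e ∷ X) Y rewrite #above-++ e X Y | #ordered-++ X Y =
  arith (#above e X) (#above e Y) (#orderedAcross X Y) (#ordered X) (#ordered Y)
  where arith : ∀ p q c x y → p + q + (c + x + y) ≡ q + c + (p + x) + y
        arith = solve-∀

#orderedAcross-++ʳ : ∀ X Y Y′ → #orderedAcross X (Y ++ Y′) ≡ #orderedAcross X Y + #orderedAcross X Y′
#orderedAcross-++ʳ []      Y Y′ = refl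
#orderedAcross-++ʳ (e ∷ X) Y Y′ rewrite #above-++ e Y Y′ | #orderedAcross-++ʳ X Y Y′ =
  arith (#above e Y) (#above e Y′) (#orderedAcross X Y) (#orderedAcross X Y′)
  where arith : ∀ p q c d → p + q + (c + d) ≡ p + c + (q + d)
        arith = solve-∀

#above-transpose : ∀ g E e f E′ → #above g (E ++ e ∷ f ∷ E′) ≡ #above g (E ++ f ∷ e ∷ E′)
#above-transpose g []      e f E′ = arith (fromBool (g ≺ᵇ e)) (fromBool (g ≺ᵇ f)) (#above g E′)
  where arith : ∀ p q c → p + (q + c) ≡ q + (p + c)
        arith = solve-∀
#above-transpose g (h ∷ E) e f E′ = cong (fromBool (g ≺ᵇ h) +_) (#above-transpose g E e f E′)

#ordered-transpose : ∀ E e f E′ → #ordered (E ++ e ∷ f ∷ E′) ≤ suc (#ordered (E ++ f ∷ e ∷ E′))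
#ordered-transpose [] e f E′ = begin
  fromBool (e ≺ᵇ f) + c₁ + (c₂ + p)        ≤⟨ +-monoˡ-≤ (c₂ + p) (+-monoˡ-≤ c₁ (fromBool≤1 (e ≺ᵇ f))) ⟩
  suc (c₁ + (c₂ + p))                      ≤⟨ s≤s (m≤m+n _ (fromBool (f ≺ᵇ e))) ⟩
  suc (c₁ + (c₂ + p) + fromBool (f ≺ᵇ e))  ≡⟨ cong suc (arith c₁ c₂ p (fromBool (f ≺ᵇ e))) ⟩
  suc (fromBool (f ≺ᵇ e) + c₂ + (c₁ + p))  ∎
  where
  open ≤-Reasoning
  c₁ c₂ p : ℕ
  c₁ = #above e E′
  c₂ = #above f E′
  p  = #ordered E′
  arith : ∀ c₁ c₂ p y → c₁ + (c₂ + p) + y ≡ y + c₂ + (c₁ + p)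
  arith = solve-∀
#ordered-transpose (g ∷ E) e f E′ rewrite #above-transpose g E e f E′ =
  ≤-trans (+-monoʳ-≤ (#above g (E ++ f ∷ e ∷ E′)) (#ordered-transpose E e f E′))
          (≤-reflexive (+-suc _ _))

commutation-#ordered : ∀ l {u v} → Commutation u v →
                       #ordered (swappedPairs l u) ≤ suc (#ordered (swappedPairs l v))
commutation-#ordered l (commute xs ys j k far) = begin
  #ordered (swappedPairs l (xs ++ j ∷ k ∷ ys))
    ≡⟨ cong #ordered (swappedPairs-++ l xs (j ∷ k ∷ ys)) ⟩
  #ordered (E ++ swappedPair j m ∷ swappedPair k (swap j m) ∷ rest)
    ≡⟨ cong (λ e → #ordered (E ++ swappedPair j m ∷ e ∷ rest)) (swappedPair-swap-far j k m far) ⟩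
  #ordered (E ++ swappedPair j m ∷ swappedPair k m ∷ rest)
    ≤⟨ #ordered-transpose E _ _ _ ⟩
  suc (#ordered (E ++ swappedPair k m ∷ swappedPair j m ∷ rest))
    ≡⟨ cong₂ (λ e s → suc (#ordered (E ++ swappedPair k m ∷ e ∷ swappedPairs s ys)))
             (swappedPair-swap-far k j m (Far-sym far)) (swap-comm-far j k m far) ⟨
  suc (#ordered (E ++ swappedPair k m ∷ swappedPair j (swap k m) ∷ swappedPairs (swap j (swap k m)) ys))
    ≡⟨ cong (λ s → suc (#ordered s)) (swappedPairs-++ l xs (k ∷ j ∷ ys)) ⟨
  suc (#ordered (swappedPairs l (xs ++ k ∷ j ∷ ys)))
    ∎
  where
  open ≤-Reasoning
  m : List ℕ
  m = act l xs
  E rest : List (ℕ × ℕ)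
  E = swappedPairs l xs
  rest = swappedPairs (swap k (swap j m)) ys

commPath-#ordered : ∀ l {u v k} → CommPath u v k →
                    #ordered (swappedPairs l u) ≤ k + #ordered (swappedPairs l v)
commPath-#ordered l ε       = ≤-refl
commPath-#ordered l (c ◅ p) = ≤-trans (commutation-#ordered l c) (s≤s (commPath-#ordered l p))

<ᵇ-true : ∀ {m n} → m < n → (m <ᵇ n) ≡ true
<ᵇ-true {zero}  {suc n} _         = refl
<ᵇ-true {suc m} {suc n} (s≤s m<n) = <ᵇ-true m<n

<ᵇ-false : ∀ {m n} → n ≤ m → (m <ᵇ n) ≡ false
<ᵇ-false {m}     {zero}  _         = refl
<ᵇ-false {suc m} {suc n} (s≤s n≤m) = <ᵇ-false n≤m

-- The extreme bit strings 0ᵇ1ᵃ and 1ᵃ0ᵇ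

0^_ 1^_ : ℕ → List Bool
0^ n = replicate n false
1^ n = replicate n true

C2-suc : ∀ n → suc n C 2 ≡ n + n C 2
C2-suc n = trans (sym (nCk+nC[k+1]≡[n+1]C[k+1] n 1)) (cong (_+ n C 2) (nC1≡n n))

#0-1^ : ∀ a → #0 (1^ a) ≡ 0
#0-1^ zero    = refl
#0-1^ (suc a) = #0-1^ a

#1-1^ : ∀ a → #1 (1^ a) ≡ a
#1-1^ zero    = refl
#1-1^ (suc a) = cong suc (#1-1^ a)

#01-1^ : ∀ a → #01 (1^ a) ≡ 0
#01-1^ zero    = refl
#01-1^ (suc a) = #01-1^ a

#11-1^ : ∀ a → #11 (1^ a) ≡ a C 2
#11-1^ zero    = refl
#11-1^ (suc a) = trans (cong₂ _+_ (#1-1^ a) (#11-1^ a)) (sym (C2-suc a))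

#011-1^ : ∀ a → #011 (1^ a) ≡ 0
#011-1^ zero    = refl
#011-1^ (suc a) = #011-1^ a

#101-1^ : ∀ a → #101 (1^ a) ≡ 0
#101-1^ zero    = refl
#101-1^ (suc a) = cong₂ _+_ (#01-1^ a) (#101-1^ a)

Ψ-1^ : ∀ a → Ψ (1^ a) ≡ 0
Ψ-1^ zero    = refl
Ψ-1^ (suc a) = Ψ-1^ a

#0-1^0^ : ∀ a b → #0 (1^ a ++ 0^ b) ≡ b
#0-1^0^ zero    zero    = refl
#0-1^0^ zero    (suc b) = cong suc (#0-1^0^ zero b)
#0-1^0^ (suc a) b       = #0-1^0^ a b

#10-1^0^ : ∀ a b → #10 (1^ a ++ 0^ b) ≡ a * b
#10-1^0^ zero    zero    = refl
#10-1^0^ zero    (suc b) = #10-1^0^ zero b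
#10-1^0^ (suc a) b       = cong₂ _+_ (#0-1^0^ a b) (#10-1^0^ a b)

#10-0^1^ : ∀ b a → #10 (0^ b ++ 1^ a) ≡ 0
#10-0^1^ zero    zero    = refl
#10-0^1^ zero    (suc a) = cong₂ _+_ (#0-1^ a) (#10-0^1^ zero a)
#10-0^1^ (suc b) a       = #10-0^1^ b a

#11-0^1^ : ∀ k a → #11 (0^ k ++ 1^ a) ≡ a C 2
#11-0^1^ zero    a = #11-1^ a
#11-0^1^ (suc k) a = #11-0^1^ k a

#011-0^1^ : ∀ k a → #011 (0^ k ++ 1^ a) ≡ k * (a C 2)
#011-0^1^ zero    a = #011-1^ a
#011-0^1^ (suc k) a = cong₂ _+_ (#11-0^1^ k a) (#011-0^1^ k a)

#101-0^1^ : ∀ k a → #101 (0^ k ++ 1^ a) ≡ 0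
#101-0^1^ zero    a = #101-1^ a
#101-0^1^ (suc k) a = #101-0^1^ k a

Ψ-0^1^ : ∀ k a → Ψ (0^ k ++ 1^ a) ≡ (a C 2) * (k C 2)
Ψ-0^1^ zero    a = trans (Ψ-1^ a) (sym (*-zeroʳ (a C 2)))
Ψ-0^1^ (suc k) a = begin
  #011 (0^ k ++ 1^ a) + #101 (0^ k ++ 1^ a) + Ψ (0^ k ++ 1^ a)
    ≡⟨ cong₂ _+_ (cong₂ _+_ (#011-0^1^ k a) (#101-0^1^ k a)) (Ψ-0^1^ k a) ⟩
  k * (a C 2) + 0 + (a C 2) * (k C 2)
    ≡⟨ arith k (a C 2) (k C 2) ⟩
  (a C 2) * (k + k C 2)
    ≡⟨ cong ((a C 2) *_) (C2-suc k) ⟨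
  (a C 2) * (suc k C 2)
    ∎
  where open ≡-Reasoning
        arith : ∀ k c d → k * c + 0 + c * d ≡ c * (k + d)
        arith = solve-∀

noAscent-0^ : ∀ b → NoAscent (0^ b)
noAscent-0^ zero          r ()
noAscent-0^ (suc zero)    r (tail-ascent ())
noAscent-0^ (suc (suc b)) r (tail-ascent a) = noAscent-0^ (suc b) _ a

noAscent-1^0^ : ∀ a b → NoAscent (1^ a ++ 0^ b)
noAscent-1^0^ zero    b = noAscent-0^ b
noAscent-1^0^ (suc a) b r (tail-ascent asc) = noAscent-1^0^ a b _ asc

-- Moving one entry across a block of consecutive positions

range : ℕ → ℕ → List ℕ
range s zero    = []
range s (suc m) = s ∷ range (suc s) m

length-range : ∀ s m → length (range s m) ≡ m
length-range s zero    = refl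
length-range s (suc m) = cong suc (length-range (suc s) m)

range-suc : ∀ s m → range s (suc m) ≡ range s m ++ (s + m) ∷ []
range-suc s zero    = cong (_∷ []) (sym (+-identityʳ s))
range-suc s (suc m) =
  cong (s ∷_) (trans (range-suc (suc s) m) (cong (λ t → range (suc s) m ++ t ∷ []) (sym (+-suc s m))))

range-+ : ∀ s m k → range s (m + k) ≡ range s m ++ range (s + m) k
range-+ s zero    k = cong (λ t → range t k) (sym (+-identityʳ s))
range-+ s (suc m) k =
  cong (s ∷_) (trans (range-+ (suc s) m k) (cong (λ t → range (suc s) m ++ range t k) (sym (+-suc s m))))

map-range : ∀ c s m → map (c +_) (range s m) ≡ range (c + s) m
map-range c s zero    = refl
map-range c s (suc m) = cong ((c + s) ∷_) (trans (map-range c (suc s) m) (cong (λ t → range t m) (+-suc c s)))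

ι≡range : ∀ n → ι n ≡ range 1 n
ι≡range n = go (λ i → i) 0 n (λ _ → refl)
  where
  go : ∀ (f : ℕ → ℕ) s n → (∀ i → f i ≡ s + i) → map suc (applyUpTo f n) ≡ range (suc s) n
  go f s zero    f≗ = refl
  go f s (suc n) f≗ = cong₂ _∷_ (cong suc (trans (f≗ 0) (+-identityʳ s)))
                               (go (λ i → f (suc i)) (suc s) n (λ i → trans (f≗ (suc i)) (+-suc s i)))

leftward rightward : ℕ → ℕ → List ℕ
leftward  k zero    = []
leftward  k (suc m) = leftward (suc k) m ++ suc k ∷ []
rightward k zero    = []
rightward k (suc m) = suc k ∷ rightward (suc k) m

leftCrossings : List ℕ → ℕ → List (ℕ × ℕ)
leftCrossings []       z = []
leftCrossings (y ∷ ys) z = leftCrossings ys z ++ (y , z) ∷ []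

length-∷ʳ : {A : Set} → ∀ (xs : List A) y → length (xs ++ y ∷ []) ≡ suc (length xs)
length-∷ʳ xs y = trans (length-++ xs) (+-comm (length xs) 1)

length-leftward : ∀ k m → length (leftward k m) ≡ m
length-leftward k zero    = refl
length-leftward k (suc m) = trans (length-∷ʳ (leftward (suc k) m) (suc k)) (cong suc (length-leftward (suc k) m))

length-rightward : ∀ k m → length (rightward k m) ≡ m
length-rightward k zero    = refl
length-rightward k (suc m) = cong suc (length-rightward (suc k) m)

move-left : ∀ xs ys z zs {k m} → length xs ≡ k → length ys ≡ m →
  act (xs ++ ys ++ z ∷ zs) (leftward k m) ≡ xs ++ z ∷ ys ++ zs ×
  swappedPairs (xs ++ ys ++ z ∷ zs) (leftward k m) ≡ leftCrossings ys z
move-left xs []       z zs _    refl = refl , refl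
move-left xs (y ∷ ys) z zs refl refl = moved , crossings
  where
  l : List ℕ
  l = xs ++ y ∷ ys ++ z ∷ zs
  w : List ℕ
  w = leftward (suc (length xs)) (length ys)
  l≡ : l ≡ (xs ++ y ∷ []) ++ ys ++ z ∷ zs
  l≡ = sym (++-assoc xs (y ∷ []) _)
  ih : act ((xs ++ y ∷ []) ++ ys ++ z ∷ zs) w ≡ (xs ++ y ∷ []) ++ z ∷ ys ++ zs ×
       swappedPairs ((xs ++ y ∷ []) ++ ys ++ z ∷ zs) w ≡ leftCrossings ys z
  ih = move-left (xs ++ y ∷ []) ys z zs (length-∷ʳ xs y) refl
  halfway : act l w ≡ xs ++ y ∷ z ∷ ys ++ zs
  halfway = trans (cong (λ t → act t w) l≡) (trans (proj₁ ih) (++-assoc xs (y ∷ []) _))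
  moved : act l (w ++ suc (length xs) ∷ []) ≡ xs ++ z ∷ y ∷ ys ++ zs
  moved = trans (act-++ l w _) (trans (cong (swap (suc (length xs))) halfway) (swap-middle xs y z _))
  crossings : swappedPairs l (w ++ suc (length xs) ∷ []) ≡ leftCrossings ys z ++ (y , z) ∷ []
  crossings = trans (swappedPairs-++ l w _)
    (cong₂ _++_ (trans (cong (λ t → swappedPairs t w) l≡) (proj₂ ih))
                (cong (_∷ []) (trans (cong (swappedPair (suc (length xs))) halfway) (swappedPair-middle xs y z _))))

move-right : ∀ xs y zs rest {k m} → length xs ≡ k → length zs ≡ m →
  act (xs ++ y ∷ zs ++ rest) (rightward k m) ≡ xs ++ zs ++ y ∷ rest ×
  swappedPairs (xs ++ y ∷ zs ++ rest) (rightward k m) ≡ map (y ,_) zs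
move-right xs y []       rest _    refl = refl , refl
move-right xs y (z ∷ zs) rest refl refl = moved , crossings
  where
  l : List ℕ
  l = xs ++ y ∷ z ∷ zs ++ rest
  w : List ℕ
  w = rightward (suc (length xs)) (length zs)
  first : swap (suc (length xs)) l ≡ (xs ++ z ∷ []) ++ y ∷ zs ++ rest
  first = trans (swap-middle xs y z _) (sym (++-assoc xs (z ∷ []) _))
  ih : act ((xs ++ z ∷ []) ++ y ∷ zs ++ rest) w ≡ (xs ++ z ∷ []) ++ zs ++ y ∷ rest ×
       swappedPairs ((xs ++ z ∷ []) ++ y ∷ zs ++ rest) w ≡ map (y ,_) zs
  ih = move-right (xs ++ z ∷ []) y zs rest (length-∷ʳ xs z) refl
  moved : act (swap (suc (length xs)) l) w ≡ xs ++ z ∷ zs ++ y ∷ rest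
  moved = trans (cong (λ t → act t w) first) (trans (proj₁ ih) (++-assoc xs (z ∷ []) _))
  crossings : swappedPair (suc (length xs)) l ∷ swappedPairs (swap (suc (length xs)) l) w
              ≡ (y , z) ∷ map (y ,_) zs
  crossings = cong₂ _∷_ (swappedPair-middle xs y z _) (trans (cong (λ t → swappedPairs t w) first) (proj₂ ih))

#larger : ℕ → List ℕ → ℕ
#larger y []       = 0
#larger y (z ∷ zs) = fromBool (y <ᵇ z) + #larger y zs

#increasing : List ℕ → List ℕ → ℕ
#increasing []       zs = 0
#increasing (y ∷ ys) zs = #larger y zs + #increasing ys zs

#larger-range : ∀ {y s} m → y < s → #larger y (range s m) ≡ m
#larger-range zero    y<s = refl
#larger-range (suc m) y<s rewrite <ᵇ-true y<s = cong suc (#larger-range m (m≤n⇒m≤1+n y<s))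

#increasing-∷ : ∀ {x s} m zs → x ≤ s → #increasing (range s m) (x ∷ zs) ≡ #increasing (range s m) zs
#increasing-∷ zero    zs x≤s = refl
#increasing-∷ (suc m) zs x≤s rewrite <ᵇ-false x≤s =
  cong (#larger _ zs +_) (#increasing-∷ m zs (m≤n⇒m≤1+n x≤s))

#increasing-range : ∀ s m → #increasing (range s m) (range s m) ≡ m C 2
#increasing-range s zero    = refl
#increasing-range s (suc m) rewrite <ᵇ-false (≤-refl {s}) =
  trans (cong₂ _+_ (#larger-range m ≤-refl)
                   (trans (#increasing-∷ m (range (suc s) m) (n≤1+n s)) (#increasing-range (suc s) m)))
        (sym (C2-suc m))

#orderedAcross-++ˡ : ∀ X X′ Y → #orderedAcross (X ++ X′) Y ≡ #orderedAcross X Y + #orderedAcross X′ Y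
#orderedAcross-++ˡ []      X′ Y = refl
#orderedAcross-++ˡ (e ∷ X) X′ Y =
  trans (cong (#above e Y +_) (#orderedAcross-++ˡ X X′ Y)) (sym (+-assoc (#above e Y) _ _))

#above-leftCrossings : ∀ y {c c′} zs → c < c′ → #above (y , c) (leftCrossings zs c′) ≡ #larger y zs
#above-leftCrossings y              []       c<c′ = refl
#above-leftCrossings y {c} {c′} (z ∷ zs) c<c′ = begin
  #above (y , c) (leftCrossings zs c′ ++ (z , c′) ∷ [])
    ≡⟨ #above-++ (y , c) (leftCrossings zs c′) _ ⟩
  #above (y , c) (leftCrossings zs c′) + (fromBool ((y <ᵇ z) ∧ (c <ᵇ c′)) + 0)
    ≡⟨ cong₂ _+_ (#above-leftCrossings y zs c<c′) (+-identityʳ _) ⟩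
  #larger y zs + fromBool ((y <ᵇ z) ∧ (c <ᵇ c′))
    ≡⟨ cong (λ t → #larger y zs + fromBool ((y <ᵇ z) ∧ t)) (<ᵇ-true c<c′) ⟩
  #larger y zs + fromBool ((y <ᵇ z) ∧ true)
    ≡⟨ cong (λ t → #larger y zs + fromBool t) (∧-identityʳ (y <ᵇ z)) ⟩
  #larger y zs + fromBool (y <ᵇ z)
    ≡⟨ +-comm (#larger y zs) _ ⟩
  fromBool (y <ᵇ z) + #larger y zs
    ∎
  where open ≡-Reasoning

#orderedAcross-leftCrossings : ∀ ys zs {c c′} → c < c′ →
  #orderedAcross (leftCrossings ys c) (leftCrossings zs c′) ≡ #increasing ys zs
#orderedAcross-leftCrossings []       zs         c<c′ = refl
#orderedAcross-leftCrossings (y ∷ ys) zs {c} {c′} c<c′ = begin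
  #orderedAcross (leftCrossings ys c ++ (y , c) ∷ []) (leftCrossings zs c′)
    ≡⟨ #orderedAcross-++ˡ (leftCrossings ys c) _ _ ⟩
  #orderedAcross (leftCrossings ys c) (leftCrossings zs c′) + (#above (y , c) (leftCrossings zs c′) + 0)
    ≡⟨ cong₂ _+_ (#orderedAcross-leftCrossings ys zs c<c′) (+-identityʳ _) ⟩
  #increasing ys zs + #above (y , c) (leftCrossings zs c′)
    ≡⟨ cong (#increasing ys zs +_) (#above-leftCrossings y zs c<c′) ⟩
  #increasing ys zs + #larger y zs
    ≡⟨ +-comm (#increasing ys zs) _ ⟩
  #larger y zs + #increasing ys zs
    ∎
  where open ≡-Reasoning

#orderedAcross-leftCrossings-same : ∀ ys y c → #orderedAcross (leftCrossings ys c) ((y , c) ∷ []) ≡ 0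
#orderedAcross-leftCrossings-same []        y c = refl
#orderedAcross-leftCrossings-same (y′ ∷ ys) y c
  rewrite #orderedAcross-++ˡ (leftCrossings ys c) ((y′ , c) ∷ []) ((y , c) ∷ [])
        | #orderedAcross-leftCrossings-same ys y c | <ᵇ-false (≤-refl {c}) | ∧-zeroʳ (y′ <ᵇ y) = refl

#ordered-leftCrossings : ∀ ys c → #ordered (leftCrossings ys c) ≡ 0
#ordered-leftCrossings []       c = refl
#ordered-leftCrossings (y ∷ ys) c
  rewrite #ordered-++ (leftCrossings ys c) ((y , c) ∷ []) | #orderedAcross-leftCrossings-same ys y c
        | #ordered-leftCrossings ys c = refl

#above-≤₁ : ∀ {c z} E → All (λ f → proj₁ f ≤ c) E → #above (c , z) E ≡ 0
#above-≤₁ []            []         = refl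
#above-≤₁ ((x , _) ∷ E) (x≤c ∷ E≤) rewrite <ᵇ-false x≤c = #above-≤₁ E E≤

#orderedAcross-[] : ∀ X → #orderedAcross X [] ≡ 0
#orderedAcross-[] []      = refl
#orderedAcross-[] (e ∷ X) = #orderedAcross-[] X

#orderedAcross-row : ∀ c zs E → All (λ f → proj₁ f ≤ c) E → #orderedAcross (map (c ,_) zs) E ≡ 0
#orderedAcross-row c []       E E≤ = refl
#orderedAcross-row c (z ∷ zs) E E≤ = cong₂ _+_ (#above-≤₁ E E≤) (#orderedAcross-row c zs E E≤)

#ordered-row : ∀ c zs → #ordered (map (c ,_) zs) ≡ 0
#ordered-row c []       = refl
#ordered-row c (z ∷ zs) =
  cong₂ _+_ (#above-≤₁ (map (c ,_) zs) (All.map⁺ (All.universal (λ _ → ≤-refl) zs))) (#ordered-row c zs)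

letter-suc : ∀ {n} k m → k + suc m < n → Letter n (suc k)
letter-suc k m h = s≤s z≤n , ≤-trans (s≤s (m<m+n k (s≤s z≤n))) h

letter-leftward : ∀ n k m → k + m < n → All (Letter n) (leftward k m)
letter-leftward n k zero    _ = []
letter-leftward n k (suc m) h =
  All.++⁺ (letter-leftward n (suc k) m (subst (_< n) (+-suc k m) h)) (letter-suc k m h ∷ [])

letter-rightward : ∀ n k m → k + m < n → All (Letter n) (rightward k m)
letter-rightward n k zero    _ = []
letter-rightward n k (suc m) h = letter-suc k m h ∷ letter-rightward n (suc k) m (subst (_< n) (+-suc k m) h)

module Diameter (a b : ℕ) where

  N : ℕ
  N = a + b

  Π : List ℕ
  Π = π21 a b

  D : ℕ
  D = (a C 2) * (b C 2)

  large : ℕ → Bool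
  large x = b <ᵇ x

  S₀ T₀ : List Bool
  S₀ = 0^ b ++ 1^ a
  T₀ = 1^ a ++ 0^ b

  ι≡ranges : ι N ≡ range 1 b ++ range (suc b) a
  ι≡ranges = trans (ι≡range (a + b)) (trans (cong (range 1) (+-comm a b)) (range-+ 1 b a))

  Π≡ranges : Π ≡ range (suc b) a ++ range 1 b
  Π≡ranges = cong₂ _++_
    (trans (cong (map (b +_)) (ι≡range a)) (trans (map-range b 1 a) (cong (λ s → range s a) (+-comm b 1))))
    (ι≡range b)

  map-large-small : ∀ s m → s + m ≤ suc b → map large (range s m) ≡ 0^ m
  map-large-small s zero    _ = refl
  map-large-small s (suc m) h = cong₂ _∷_
    (<ᵇ-false (≤-pred (≤-trans (m<m+n s (s≤s z≤n)) h)))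
    (map-large-small (suc s) m (subst (_≤ suc b) (+-suc s m) h))

  map-large-large : ∀ s m → b < s → map large (range s m) ≡ 1^ m
  map-large-large s zero    _   = refl
  map-large-large s (suc m) b<s = cong₂ _∷_ (<ᵇ-true b<s) (map-large-large (suc s) m (m≤n⇒m≤1+n b<s))

  map-large-ι : map large (ι N) ≡ S₀
  map-large-ι = trans (cong (map large) ι≡ranges)
    (trans (map-++ large (range 1 b) _)
           (cong₂ _++_ (map-large-small 1 b ≤-refl) (map-large-large (suc b) a ≤-refl)))

  map-large-Π : map large Π ≡ T₀
  map-large-Π = trans (cong (map large) Π≡ranges)
    (trans (map-++ large (range (suc b) a) _)
           (cong₂ _++_ (map-large-large (suc b) a ≤-refl) (map-large-small 1 b ≤-refl)))

  act-S₀ : ∀ w → prod N w ≡ Π → act S₀ w ≡ T₀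
  act-S₀ w w↦Π = begin
    act S₀ w                  ≡⟨ cong (λ s → act s w) map-large-ι ⟨
    act (map large (ι N)) w   ≡⟨ map-act large (ι N) w ⟨
    map large (act (ι N) w)   ≡⟨ cong (map large) (prod≡act N w) ⟨
    map large (prod N w)      ≡⟨ cong (map large) w↦Π ⟩
    map large Π               ≡⟨ map-large-Π ⟩
    T₀                        ∎
    where open ≡-Reasoning

  word-length : ∀ {w} → IsWord N Π w → a * b ≤ length w
  word-length {w} (_ , w↦Π) = begin
    a * b                ≡⟨ #10-1^0^ a b ⟨
    #10 T₀               ≡⟨ cong #10 (act-S₀ w w↦Π) ⟨
    #10 (act S₀ w)       ≤⟨ #10-act-≤ S₀ w ⟩
    length w + #10 S₀    ≡⟨ cong (length w +_) (#10-0^1^ b a) ⟩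
    length w + 0         ≡⟨ +-identityʳ (length w) ⟩
    length w             ∎
    where open ≤-Reasoning

  reduced : ∀ {w} → IsWord N Π w → length w ≡ a * b → Reduced N Π w
  reduced word len = word , λ w′ word′ → subst (_≤ length w′) (sym len) (word-length word′)

  -- u₀ = U 0 a moves the large entries b+1, …, b+a in turn leftwards past the small ones;
  -- v₀ = V b moves the small entries b, …, 1 in turn rightwards past the large ones.

  U : ℕ → ℕ → List ℕ
  U i zero    = []
  U i (suc m) = leftward i b ++ U (suc i) m

  startU : ℕ → ℕ → List ℕ
  startU i m = range (suc b) i ++ range 1 b ++ range (suc b + i) m

  pairsU : ℕ → ℕ → List (ℕ × ℕ)
  pairsU i zero    = []
  pairsU i (suc m) = leftCrossings (range 1 b) (suc b + i) ++ pairsU (suc i) m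

  act-U : ∀ i m → act (startU i m) (U i m) ≡ range (suc b) (i + m) ++ range 1 b ×
                  swappedPairs (startU i m) (U i m) ≡ pairsU i m
  act-U i zero    = trans (cong (range (suc b) i ++_) (++-identityʳ (range 1 b)))
                          (cong (λ k → range (suc b) k ++ range 1 b) (sym (+-identityʳ i))) , refl
  act-U i (suc m) = moved , crossings
    where
    l : List ℕ
    l = startU i (suc m)
    block : act l (leftward i b) ≡ range (suc b) i ++ (suc b + i) ∷ range 1 b ++ range (suc (suc b + i)) m ×
            swappedPairs l (leftward i b) ≡ leftCrossings (range 1 b) (suc b + i)
    block = move-left (range (suc b) i) (range 1 b) (suc b + i) _ (length-range _ i) (length-range 1 b)
    halfway : act l (leftward i b) ≡ startU (suc i) m
    halfway = trans (proj₁ block)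
      (trans (sym (++-assoc (range (suc b) i) ((suc b + i) ∷ []) _))
             (cong₂ _++_ (sym (range-suc (suc b) i)) (cong (λ s → range 1 b ++ range s m) (sym (+-suc (suc b) i)))))
    ih : act (startU (suc i) m) (U (suc i) m) ≡ range (suc b) (suc i + m) ++ range 1 b ×
         swappedPairs (startU (suc i) m) (U (suc i) m) ≡ pairsU (suc i) m
    ih = act-U (suc i) m
    moved : act l (leftward i b ++ U (suc i) m) ≡ range (suc b) (i + suc m) ++ range 1 b
    moved = trans (act-++ l (leftward i b) _) (trans (cong (λ t → act t (U (suc i) m)) halfway)
              (trans (proj₁ ih) (cong (λ k → range (suc b) k ++ range 1 b) (sym (+-suc i m)))))
    crossings : swappedPairs l (leftward i b ++ U (suc i) m) ≡ pairsU i (suc m)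
    crossings = trans (swappedPairs-++ l (leftward i b) _)
      (cong₂ _++_ (proj₂ block) (trans (cong (λ t → swappedPairs t (U (suc i) m)) halfway) (proj₂ ih)))

  V : ℕ → List ℕ
  V zero    = []
  V (suc m) = rightward m a ++ V m

  startV : ℕ → ℕ → List ℕ
  startV m j = range 1 m ++ range (suc b) a ++ range (suc m) j

  pairsV : ℕ → List (ℕ × ℕ)
  pairsV zero    = []
  pairsV (suc m) = map (suc m ,_) (range (suc b) a) ++ pairsV m

  act-V : ∀ m j → act (startV m j) (V m) ≡ range (suc b) a ++ range 1 (m + j) ×
                  swappedPairs (startV m j) (V m) ≡ pairsV m
  act-V zero    j = refl , refl
  act-V (suc m) j = moved , crossings
    where
    l : List ℕ
    l = startV (suc m) j
    l≡ : l ≡ range 1 m ++ suc m ∷ range (suc b) a ++ range (suc (suc m)) j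
    l≡ = trans (cong (_++ range (suc b) a ++ range (suc (suc m)) j) (range-suc 1 m))
               (++-assoc (range 1 m) (suc m ∷ []) _)
    block : act l (rightward m a) ≡ startV m (suc j) × swappedPairs l (rightward m a) ≡ map (suc m ,_) (range (suc b) a)
    block = subst (λ t → act t (rightward m a) ≡ startV m (suc j) ×
                         swappedPairs t (rightward m a) ≡ map (suc m ,_) (range (suc b) a)) (sym l≡)
              (move-right (range 1 m) (suc m) (range (suc b) a) _ (length-range 1 m) (length-range (suc b) a))
    ih : act (startV m (suc j)) (V m) ≡ range (suc b) a ++ range 1 (m + suc j) ×
         swappedPairs (startV m (suc j)) (V m) ≡ pairsV m
    ih = act-V m (suc j)
    moved : act l (rightward m a ++ V m) ≡ range (suc b) a ++ range 1 (suc m + j)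
    moved = trans (act-++ l (rightward m a) (V m)) (trans (cong (λ t → act t (V m)) (proj₁ block))
              (trans (proj₁ ih) (cong (λ k → range (suc b) a ++ range 1 k) (+-suc m j))))
    crossings : swappedPairs l (rightward m a ++ V m) ≡ pairsV (suc m)
    crossings = trans (swappedPairs-++ l (rightward m a) (V m))
      (cong₂ _++_ (proj₂ block) (trans (cong (λ t → swappedPairs t (V m)) (proj₁ block)) (proj₂ ih)))

  u₀ v₀ : List ℕ
  u₀ = U 0 a
  v₀ = V b

  ι≡startU : ι N ≡ startU 0 a
  ι≡startU = trans ι≡ranges (cong (λ s → range 1 b ++ range s a) (sym (+-identityʳ (suc b))))

  ι≡startV : ι N ≡ startV b 0
  ι≡startV = trans ι≡ranges (cong (range 1 b ++_) (sym (++-identityʳ _)))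

  u₀-word : IsWord N Π u₀
  u₀-word = letters 0 a ≤-refl , (begin
    prod N u₀                     ≡⟨ prod≡act N u₀ ⟩
    act (ι N) u₀                  ≡⟨ cong (λ s → act s u₀) ι≡startU ⟩
    act (startU 0 a) u₀           ≡⟨ proj₁ (act-U 0 a) ⟩
    range (suc b) a ++ range 1 b  ≡⟨ Π≡ranges ⟨
    Π                             ∎)
    where
    open ≡-Reasoning
    letters : ∀ i m → i + m ≤ a → All (Letter N) (U i m)
    letters i zero    _ = []
    letters i (suc m) h = All.++⁺
      (letter-leftward N i b (+-monoˡ-< b (≤-trans (m<m+n i (s≤s z≤n)) h)))
      (letters (suc i) m (subst (_≤ a) (+-suc i m) h))

  v₀-word : IsWord N Π v₀
  v₀-word = letters b ≤-refl , (begin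
    prod N v₀                           ≡⟨ prod≡act N v₀ ⟩
    act (ι N) v₀                        ≡⟨ cong (λ s → act s v₀) ι≡startV ⟩
    act (startV b 0) v₀                 ≡⟨ proj₁ (act-V b 0) ⟩
    range (suc b) a ++ range 1 (b + 0)  ≡⟨ cong (λ k → range (suc b) a ++ range 1 k) (+-identityʳ b) ⟩
    range (suc b) a ++ range 1 b        ≡⟨ Π≡ranges ⟨
    Π                                   ∎)
    where
    open ≡-Reasoning
    letters : ∀ m → m ≤ b → All (Letter N) (V m)
    letters zero    _ = []
    letters (suc m) h = All.++⁺ (letter-rightward N m a (subst (_< N) (+-comm a m) (+-monoʳ-< a h)))
                                (letters m (≤-trans (n≤1+n m) h))

  length-U : ∀ i m → length (U i m) ≡ m * b
  length-U i zero    = refl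
  length-U i (suc m) = trans (length-++ (leftward i b)) (cong₂ _+_ (length-leftward i b) (length-U (suc i) m))

  length-V : ∀ m → length (V m) ≡ m * a
  length-V zero    = refl
  length-V (suc m) = trans (length-++ (rightward m a)) (cong₂ _+_ (length-rightward m a) (length-V m))

  u₀-reduced : Reduced N Π u₀
  u₀-reduced = reduced u₀-word (length-U 0 a)

  v₀-reduced : Reduced N Π v₀
  v₀-reduced = reduced v₀-word (trans (length-V b) (*-comm b a))

  #orderedAcross-pairsU : ∀ i j m → i < j →
    #orderedAcross (leftCrossings (range 1 b) (suc b + i)) (pairsU j m) ≡ m * (b C 2)
  #orderedAcross-pairsU i j zero    i<j = #orderedAcross-[] (leftCrossings (range 1 b) (suc b + i))
  #orderedAcross-pairsU i j (suc m) i<j = begin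
    #orderedAcross X (leftCrossings (range 1 b) (suc b + j) ++ pairsU (suc j) m)
      ≡⟨ #orderedAcross-++ʳ X (leftCrossings (range 1 b) (suc b + j)) _ ⟩
    #orderedAcross X (leftCrossings (range 1 b) (suc b + j)) + #orderedAcross X (pairsU (suc j) m)
      ≡⟨ cong₂ _+_ (#orderedAcross-leftCrossings (range 1 b) (range 1 b) (+-monoʳ-< (suc b) i<j))
                   (#orderedAcross-pairsU i (suc j) m (m≤n⇒m≤1+n i<j)) ⟩
    #increasing (range 1 b) (range 1 b) + m * (b C 2)
      ≡⟨ cong (_+ m * (b C 2)) (#increasing-range 1 b) ⟩
    b C 2 + m * (b C 2)
      ∎
    where
    open ≡-Reasoning
    X : List (ℕ × ℕ)
    X = leftCrossings (range 1 b) (suc b + i)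

  #ordered-pairsU : ∀ i m → #ordered (pairsU i m) ≡ (m C 2) * (b C 2)
  #ordered-pairsU i zero    = refl
  #ordered-pairsU i (suc m) = begin
    #ordered (X ++ pairsU (suc i) m)
      ≡⟨ #ordered-++ X (pairsU (suc i) m) ⟩
    #orderedAcross X (pairsU (suc i) m) + #ordered X + #ordered (pairsU (suc i) m)
      ≡⟨ cong₂ _+_ (cong₂ _+_ (#orderedAcross-pairsU i (suc i) m ≤-refl)
                              (#ordered-leftCrossings (range 1 b) _))
                   (#ordered-pairsU (suc i) m) ⟩
    m * (b C 2) + 0 + (m C 2) * (b C 2)
      ≡⟨ cong (_+ (m C 2) * (b C 2)) (+-identityʳ _) ⟩
    m * (b C 2) + (m C 2) * (b C 2)
      ≡⟨ *-distribʳ-+ (b C 2) m (m C 2) ⟨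
    (m + m C 2) * (b C 2)
      ≡⟨ cong (_* (b C 2)) (C2-suc m) ⟨
    (suc m C 2) * (b C 2)
      ∎
    where
    open ≡-Reasoning
    X : List (ℕ × ℕ)
    X = leftCrossings (range 1 b) (suc b + i)

  pairsV-≤ : ∀ {c} m → m ≤ c → All (λ f → proj₁ f ≤ c) (pairsV m)
  pairsV-≤ zero    _ = []
  pairsV-≤ (suc m) h =
    All.++⁺ (All.map⁺ (All.universal (λ _ → h) (range (suc b) a))) (pairsV-≤ m (≤-trans (n≤1+n m) h))

  #ordered-pairsV : ∀ m → #ordered (pairsV m) ≡ 0
  #ordered-pairsV zero    = refl
  #ordered-pairsV (suc m) = begin
    #ordered (X ++ pairsV m)
      ≡⟨ #ordered-++ X (pairsV m) ⟩
    #orderedAcross X (pairsV m) + #ordered X + #ordered (pairsV m)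
      ≡⟨ cong₂ _+_ (cong₂ _+_ (#orderedAcross-row (suc m) zs (pairsV m) (pairsV-≤ m (n≤1+n m)))
                              (#ordered-row (suc m) zs))
                   (#ordered-pairsV m) ⟩
    0
      ∎
    where
    open ≡-Reasoning
    zs : List ℕ
    zs = range (suc b) a
    X : List (ℕ × ℕ)
    X = map (suc m ,_) zs

  #ordered-u₀ : #ordered (swappedPairs (ι N) u₀) ≡ D
  #ordered-u₀ = trans (cong (λ s → #ordered (swappedPairs s u₀)) ι≡startU)
                      (trans (cong #ordered (proj₂ (act-U 0 a))) (#ordered-pairsU 0 a))

  #ordered-v₀ : #ordered (swappedPairs (ι N) v₀) ≡ 0
  #ordered-v₀ = trans (cong (λ s → #ordered (swappedPairs s v₀)) ι≡startV)
                      (trans (cong #ordered (proj₂ (act-V b 0))) (#ordered-pairsV b))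

  reduced-length : ∀ {u} → Reduced N Π u → length u ≡ a * b
  reduced-length {u} (word , minimal) =
    ≤-antisym (subst (length u ≤_) (length-U 0 a) (minimal u₀ u₀-word)) (word-length word)

  reduced-AscentWord : ∀ {u} → Reduced N Π u → AscentWord S₀ u
  reduced-AscentWord {u} r@((_ , u↦Π) , _) = #10-act⇒AscentWord S₀ u (begin
    #10 (act S₀ u)      ≡⟨ cong #10 (act-S₀ u u↦Π) ⟩
    #10 T₀              ≡⟨ #10-1^0^ a b ⟩
    a * b               ≡⟨ reduced-length r ⟨
    length u            ≡⟨ +-identityʳ (length u) ⟨
    length u + 0        ≡⟨ cong (length u +_) (#10-0^1^ b a) ⟨
    length u + #10 S₀   ∎)
    where open ≡-Reasoning

  walk⇒commPath : ∀ {u v k} → Walk N Π u v k → CommPath u v k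
  walk⇒commPath (here _)      = ε
  walk⇒commPath (step r m w) = AscentWord-move⇒commutation (reduced-AscentWord r) m ◅ walk⇒commPath w

  upper-bound : ∀ {u v} → Reduced N Π u → Reduced N Π v → ∃[ k ] (CommPath u v k × k ≤ D)
  upper-bound {u} {v} ru@((_ , u↦Π) , _) rv@((_ , v↦Π) , _)
    with connect S₀ u v (reduced-AscentWord ru) (reduced-AscentWord rv)
                 (trans (act-S₀ u u↦Π) (sym (act-S₀ v v↦Π)))
                 (subst NoAscent (sym (act-S₀ u u↦Π)) (noAscent-1^0^ a b))
  ... | k , p , k≤Ψ = k , p , subst (k ≤_) (Ψ-0^1^ b a) k≤Ψ

  lower-bound : ∀ {k} → CommPath u₀ v₀ k → D ≤ k
  lower-bound {k} p = begin
    D                                             ≡⟨ #ordered-u₀ ⟨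
    #ordered (swappedPairs (ι N) u₀)              ≤⟨ commPath-#ordered (ι N) p ⟩
    k + #ordered (swappedPairs (ι N) v₀)          ≡⟨ cong (k +_) #ordered-v₀ ⟩
    k + 0                                         ≡⟨ +-identityʳ k ⟩
    k                                             ∎
    where open ≤-Reasoning

  distance : ∀ u v → Reduced N Π u → Reduced N Π v → ∃[ d ] (Dist N Π u v d × d ≤ D)
  distance u v ru rv with upper-bound ru rv
  ... | k , p , k≤D with least (λ k → commPath? k u v) p
  ...   | d , pd , minimal =
    d , (commPath⇒walk ru pd , λ k w → minimal k (walk⇒commPath w)) , ≤-trans (minimal k p) k≤D

  diameter : IsDiameter N Π D
  diameter = distance , u₀ , v₀ , u₀-reduced , v₀-reduced , exact
    where
    exact : Dist N Π u₀ v₀ D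
    exact with distance u₀ v₀ u₀-reduced v₀-reduced
    ... | d , (w , minimal) , d≤D =
      subst (Dist N Π u₀ v₀) (≤-antisym d≤D (lower-bound (walk⇒commPath w))) (w , minimal)

lemma6p14 : (a b : ℕ) → 1 ≤ a → 1 ≤ b →
    IsDiameter (a + b) (π21 a b) ((a C 2) * (b C 2))
lemma6p14 a b _ _ = Diameter.diameter a b
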